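{- Let $k\geq 3$. For every integer $\ell\geq 2$, $\frac{1}{2(k-1)^{\ell}}\leq\gamma(Z^{(k)}_\ell)$.
   Context: A $k$-graph $H$ has vertex set $V(H)$ and edge set consisting of $k$-subsets of $V(H)$. The minimum codegree $\delta(H)$ is the minimum, over all $(k-1)$-subsets $S\subseteq V(H)$, of the number of edges containing $S$. For a $k$-graph $F$, $\mathrm{ex}_{\mathrm{co}}(n,F)$ is the maximum $d$ such that some $n$-vertex $k$-graph with no copy of $F$ has $\delta\geq d$, and $\gamma(F)=\lim_{n\to\infty}\mathrm{ex}_{\mathrm{co}}(n,F)/n$. For integers $\ell\geq 2$, the zycle $Z^{(k)}_\ell$ is the $k$-graph with vertex set $\{v_i^j: i\in[\ell], j\in[k-1]\}$ and edge set $\{\{v_i^1,\dots,v_i^{k-1},v_{i+1}^j\}: i\in[\ell], j\in[k-1]\}$, indices $i$ modulo $\ell$. -}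

module Defs where

open import Data.Bool using (Bool; true; false; _∧_; _∨_; not)
open import Data.Nat using (ℕ; zero; suc; _+_; _*_; _∸_; _^_; _≤_; _≥_)
open import Data.Nat.DivMod using (_mod_)
open import Data.Fin using (Fin; zero; suc; toℕ; combine; _≟_)
open import Data.Fin.Subset using (Subset; ∣_∣; _∪_; ⁅_⁆)
open import Data.Vec using (lookup; tabulate)
open import Data.Product using (Σ; ∃; ∃-syntax; _×_; _,_)
open import Relation.Nullary using (¬_; does)
open import Relation.Binary.PropositionalEquality using (_≡_)
open import Function.Definitions using (Injective)

anyᵇ : {m : ℕ} → (Fin m → Bool) → Bool
anyᵇ {zero}  p = false
anyᵇ {suc m} p = p zero ∨ anyᵇ (λ i → p (suc i))

_==_ : {n : ℕ} → Fin n → Fin n → Bool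
i == j = does (i ≟ j)

HostGraph : ℕ → Set
HostGraph n = Subset n → Bool

IsKGraph : (k : ℕ) {n : ℕ} → HostGraph n → Set
IsKGraph k {n} H = (e : Subset n) → H e ≡ true → ∣ e ∣ ≡ k

-- Number of edges of the k-graph H containing the (k-1)-set S:
-- each such edge is S ∪ {v} for a unique vertex v ∉ S.
codeg : {n : ℕ} → HostGraph n → Subset n → ℕ
codeg H S = ∣ tabulate (λ v → not (lookup S v) ∧ H (S ∪ ⁅ v ⁆)) ∣

MinCodegAtLeast : (k : ℕ) {n : ℕ} → HostGraph n → ℕ → Set
MinCodegAtLeast k {n} H d = (S : Subset n) → ∣ S ∣ ≡ k ∸ 1 → d ≤ codeg H S

image : {m n : ℕ} → (Fin m → Fin n) → Subset m → Subset n
image φ e = tabulate (λ w → anyᵇ (λ v → lookup e v ∧ (φ v == w)))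

Pattern : ℕ → Set₁
Pattern m = Subset m → Set

ContainsCopy : {m n : ℕ} → Pattern m → HostGraph n → Set
ContainsCopy {m} {n} F H =
  Σ (Fin m → Fin n) λ φ → Injective _≡_ _≡_ φ ×
    ((e : Subset m) → F e → H (image φ e) ≡ true)

-- The zycle Z^{(k)}_ℓ.  Vertex v_i^j (i ∈ Fin ℓ, j ∈ Fin (k-1)) is
-- encoded as  combine i j : Fin (ℓ * (k ∸ 1)).

sucMod : {ℓ : ℕ} → Fin ℓ → Fin ℓ
sucMod {suc ℓ} i = suc (toℕ i) mod (suc ℓ)

zedge : (k : ℕ) {ℓ : ℕ} → Fin ℓ → Fin (k ∸ 1) → Subset (ℓ * (k ∸ 1))
zedge k i j = tabulate (λ w →
  anyᵇ (λ j′ → combine i j′ == w) ∨ (combine (sucMod i) j == w))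

Zycle : (k ℓ : ℕ) → Pattern (ℓ * (k ∸ 1))
Zycle k ℓ e = ∃[ i ] ∃[ j ] e ≡ zedge k {ℓ} i j

-- ex_co(n, F) ≥ d : some n-vertex F-free k-graph has δ ≥ d
-- (ex_co is a maximum, and the empty k-graph witnesses d = 0).
ExCoAtLeast : (k : ℕ) {m : ℕ} → Pattern m → (n d : ℕ) → Set
ExCoAtLeast k F n d =
  Σ (HostGraph n) λ H → IsKGraph k H × ¬ ContainsCopy F H × MinCodegAtLeast k H d

{-# OPTIONS --safe #-}
-- Let a = k - 1 and M = |1 - (-a)^ℓ| ≤ 2a^ℓ. Colour the vertex v of Fin n by v mod M and take as
-- edges the k-sets whose colours sum to 1 modulo M. A (k-1)-set S is completed to an edge by every
-- vertex outside S of one particular colour, so the minimum codegree is at least n/M - a. In a copy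
-- of the zycle, the vertices of block i+1 all complete block i, hence share a colour x_i, and
-- a x_i + x_{i+1} ≡ 1 (mod M) around the cycle; no ℓ-periodic sequence satisfies this recurrence.
module Submission where

import Data.Nat.Base as ℕ
import Data.Nat.Properties as ℕ
import Data.Nat.Divisibility as ℕ
open import Relation.Nullary using (¬_; Dec; does; yes; no)
open import Relation.Binary.PropositionalEquality

-- Affine recurrences modulo |1 - (-a)^ℓ|

module ZycleArithmetic where
  open import Data.Nat.Base using (ℕ; zero; suc; NonZero)
  open import Data.Nat.DivMod using (_%_; _/_; m≡m%n+[m/n]*n)
  open import Data.Integer using (ℤ; +_; _+_; _*_; _-_; -_; _^_; 0ℤ; 1ℤ; ∣_∣)
  open import Data.Integer.Properties using (abs-*; pos-+; pos-*; ∣-i∣≡∣i∣; ∣i-j∣≤∣i∣+∣j∣)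
  open import Data.Integer.Divisibility.Signed
    using (_∣_; divides; ∣ᵤ⇒∣; ∣⇒∣ᵤ; ∣-refl; ∣m∣n⇒∣m-n; ∣n⇒∣m*n; ∣m⇒∣m*n; *-monoʳ-∣)
  open import Data.Integer.Tactic.RingSolver using (solve-∀)

  zycleModulus : ℕ → ℕ → ℕ
  zycleModulus a ℓ = ∣ 1ℤ - (- + a) ^ ℓ ∣

  ∣i^n∣≡∣i∣^n : ∀ i n → ∣ i ^ n ∣ ≡ ∣ i ∣ ℕ.^ n
  ∣i^n∣≡∣i∣^n i zero    = refl
  ∣i^n∣≡∣i∣^n i (suc n) = trans (abs-* i (i ^ n)) (cong (∣ i ∣ ℕ.*_) (∣i^n∣≡∣i∣^n i n))

  ∣-a^ℓ∣≡a^ℓ : ∀ a ℓ → ∣ (- + a) ^ ℓ ∣ ≡ a ℕ.^ ℓ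
  ∣-a^ℓ∣≡a^ℓ a ℓ = trans (∣i^n∣≡∣i∣^n (- + a) ℓ) (cong (ℕ._^ ℓ) (∣-i∣≡∣i∣ (+ a)))

  zycleModulus≤1+a^ℓ : ∀ a ℓ → zycleModulus a ℓ ℕ.≤ 1 ℕ.+ a ℕ.^ ℓ
  zycleModulus≤1+a^ℓ a ℓ =
    subst (zycleModulus a ℓ ℕ.≤_) (cong (1 ℕ.+_) (∣-a^ℓ∣≡a^ℓ a ℓ)) (∣i-j∣≤∣i∣+∣j∣ 1ℤ ((- + a) ^ ℓ))

  a^ℓ≤1+zycleModulus : ∀ a ℓ → a ℕ.^ ℓ ℕ.≤ 1 ℕ.+ zycleModulus a ℓ
  a^ℓ≤1+zycleModulus a ℓ = subst₂ ℕ._≤_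
    (trans (cong ∣_∣ (flip1 ((- + a) ^ ℓ))) (∣-a^ℓ∣≡a^ℓ a ℓ)) refl
    (∣i-j∣≤∣i∣+∣j∣ 1ℤ (1ℤ - (- + a) ^ ℓ))
    where
    flip1 : ∀ x → 1ℤ - (1ℤ - x) ≡ x
    flip1 = solve-∀

  %≡1⇒∣[m-1] : ∀ m d .{{_ : NonZero d}} → m % d ≡ 1 → + d ∣ + m - 1ℤ
  %≡1⇒∣[m-1] m d m%d≡1 = divides (+ (m / d)) (begin
    + m - 1ℤ                        ≡⟨ cong (λ x → + x - 1ℤ) (m≡m%n+[m/n]*n m d) ⟩
    + (m % d ℕ.+ m / d ℕ.* d) - 1ℤ  ≡⟨ cong (λ r → + (r ℕ.+ m / d ℕ.* d) - 1ℤ) m%d≡1 ⟩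
    + (1 ℕ.+ m / d ℕ.* d) - 1ℤ      ≡⟨ cong (_- 1ℤ) (pos-+ 1 (m / d ℕ.* d)) ⟩
    1ℤ + + (m / d ℕ.* d) - 1ℤ       ≡⟨ cancel (+ (m / d ℕ.* d)) ⟩
    + (m / d ℕ.* d)                 ≡⟨ pos-* (m / d) d ⟩
    + (m / d) * + d                 ∎)
    where
    open ≡-Reasoning
    cancel : ∀ x → 1ℤ + x - 1ℤ ≡ x
    cancel = solve-∀

  affine-%≡1⇒∣ : ∀ a x y d .{{_ : NonZero d}} → (a ℕ.* x ℕ.+ y) % d ≡ 1 → + d ∣ + a * + x + + y - 1ℤ
  affine-%≡1⇒∣ a x y d eq = subst (λ z → + d ∣ z - 1ℤ)
    (trans (pos-+ (a ℕ.* x) y) (cong (_+ + y) (pos-* a x))) (%≡1⇒∣[m-1] _ d eq)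

  -- An orbit of x ↦ 1 - a x modulo M = |1 - (-a)^ℓ| is never ℓ-periodic: after the substitution
  -- y = (1 + a) x - 1 the map becomes y ↦ -a y modulo (1 + a) M, so one period forces 1 + a ∣ 1.
  no-periodic-orbit : ∀ a ℓ .{{_ : NonZero a}} .{{_ : NonZero (zycleModulus a ℓ)}} (u : ℕ → ℕ) →
    (∀ j → (a ℕ.* u j ℕ.+ u (suc j)) % zycleModulus a ℓ ≡ 1) → u ℓ ≢ u 0
  no-periodic-orbit a ℓ u u-recurrence u-periodic = 1+a∤1 (∣⇒∣ᵤ 1+a∣1)
    where
    A M : ℤ
    A = + a
    M = + zycleModulus a ℓ

    x : ℕ → ℤ
    x j = + u j

    recurrence : ∀ j → M ∣ A * x j + x (suc j) - 1ℤ
    recurrence j = affine-%≡1⇒∣ a (u j) (u (suc j)) (zycleModulus a ℓ) (u-recurrence j)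

    periodic : x ℓ ≡ x 0
    periodic = cong +_ u-periodic

    y : ℕ → ℤ
    y j = (1ℤ + A) * x j - 1ℤ

    orbit : ∀ j → (1ℤ + A) * M ∣ y j - (- A) ^ j * y 0
    orbit zero = divides 0ℤ (vanish (y 0) ((1ℤ + A) * M))
      where
      vanish : ∀ y₀ N → y₀ - 1ℤ * y₀ ≡ 0ℤ * N
      vanish = solve-∀
    orbit (suc j) = subst ((1ℤ + A) * M ∣_) (sym (step A (x j) (x (suc j)) (x 0) ((- A) ^ j)))
      (∣m∣n⇒∣m-n (*-monoʳ-∣ (1ℤ + A) (recurrence j)) (∣n⇒∣m*n A (orbit j)))
      where
      step : ∀ A x x′ x₀ e → ((1ℤ + A) * x′ - 1ℤ) - (- A * e) * ((1ℤ + A) * x₀ - 1ℤ)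
           ≡ (1ℤ + A) * (A * x + x′ - 1ℤ) - A * (((1ℤ + A) * x - 1ℤ) - e * ((1ℤ + A) * x₀ - 1ℤ))
      step = solve-∀

    one-period : (1ℤ + A) * M ∣ (1ℤ - (- A) ^ ℓ) * y 0
    one-period = subst ((1ℤ + A) * M ∣_) (factor (y 0) ((- A) ^ ℓ))
      (subst (λ z → (1ℤ + A) * M ∣ z - (- A) ^ ℓ * y 0) (cong (λ z → (1ℤ + A) * z - 1ℤ) periodic) (orbit ℓ))
      where
      factor : ∀ y₀ e → y₀ - e * y₀ ≡ (1ℤ - e) * y₀
      factor = solve-∀

    1+a∣y0 : 1ℤ + A ∣ y 0
    1+a∣y0 = ∣ᵤ⇒∣ (ℕ.*-cancelʳ-∣ (zycleModulus a ℓ) (subst₂ ℕ._∣_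
      (abs-* (1ℤ + A) M)
      (trans (abs-* (1ℤ - (- A) ^ ℓ) (y 0)) (ℕ.*-comm (zycleModulus a ℓ) ∣ y 0 ∣))
      (∣⇒∣ᵤ one-period)))

    1+a∣1 : 1ℤ + A ∣ 1ℤ
    1+a∣1 = subst (1ℤ + A ∣_) (unit A (x 0)) (∣m∣n⇒∣m-n (∣m⇒∣m*n (x 0) ∣-refl) 1+a∣y0)
      where
      unit : ∀ A x₀ → (1ℤ + A) * x₀ - ((1ℤ + A) * x₀ - 1ℤ) ≡ 1ℤ
      unit = solve-∀

    1+a∤1 : ¬ suc a ℕ.∣ 1
    1+a∤1 1+a∣1 = ℕ.≢-nonZero⁻¹ a (ℕ.suc-injective (ℕ.∣1⇒≡1 1+a∣1))

open ZycleArithmetic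

open import Data.Bool using (Bool; true; false; T; _∧_; _∨_; not)
open import Data.Bool.Properties using (∨-comm; ∧-zeroʳ; T-≡)
open import Data.Fin using (Fin; zero; suc; toℕ; combine)
import Data.Fin as Fin
open import Data.Fin.Properties
  using (toℕ-fromℕ<; toℕ-injective; toℕ<n; combine-injectiveˡ; combine-injectiveʳ; 0≢1+n)
  renaming (suc-injective to Fin-suc-injective)
open import Data.Fin.Subset using (Subset; ∣_∣; _∪_; ⁅_⁆; ⊤; inside; outside; _∈_; _⊆_)
open import Data.Fin.Subset.Properties using (∪-identityʳ; p⊆q⇒∣p∣≤∣q∣; x∈p∪q⁺)
open import Data.Nat
  using (ℕ; zero; suc; _+_; _*_; _∸_; _^_; _≤_; _<_; _≥_; _≡ᵇ_; z≤n; s≤s; NonZero; >-nonZero; >-nonZero⁻¹)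
open import Data.Nat.DivMod
  using (_%_; _/_; _mod_; %-distribˡ-+; m%n%n≡m%n; m%n<n; m%n≤n; [m+n]%n≡m%n; m<n⇒m%n≡m; n%n≡0; m≡m%n+[m/n]*n)
open import Data.Nat.Properties hiding (_≟_; suc-injective; 0≢1+n)
open import Data.Product using (∃-syntax; _×_; _,_; proj₁; proj₂)
open import Data.Sum using (inj₁; inj₂)
open import Data.Vec using (Vec; _∷_; []; lookup; tabulate)
open import Data.Vec.Properties
  using (lookup∘tabulate; tabulate∘lookup; tabulate-cong; lookup-zipWith; lookup-replicate; []=⇒lookup; lookup⇒[]=)
open import Function using (_∘_; const; Equivalence)
open import Function.Definitions using (Injective)
open import Relation.Nullary.Decidable using (_×-dec_; dec-true; dec-false)
open import Defs

-- Residues and counting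

module _ {d : ℕ} .{{_ : NonZero d}} where
  open ≡-Reasoning

  [m+n%d]%d≡[m+n]%d : ∀ m n → (m + n % d) % d ≡ (m + n) % d
  [m+n%d]%d≡[m+n]%d m n = begin
    (m + n % d) % d          ≡⟨ %-distribˡ-+ m (n % d) d ⟩
    (m % d + n % d % d) % d  ≡⟨ cong (λ x → (m % d + x) % d) (m%n%n≡m%n n d) ⟩
    (m % d + n % d) % d      ≡⟨ %-distribˡ-+ m n d ⟨
    (m + n) % d              ∎

  [m%d+n]%d≡[m+n]%d : ∀ m n → (m % d + n) % d ≡ (m + n) % d
  [m%d+n]%d≡[m+n]%d m n = begin
    (m % d + n) % d  ≡⟨ cong (_% d) (+-comm (m % d) n) ⟩
    (n + m % d) % d  ≡⟨ [m+n%d]%d≡[m+n]%d n m ⟩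
    (n + m) % d      ≡⟨ cong (_% d) (+-comm n m) ⟩
    (m + n) % d      ∎

  %-complement : ∀ m r → r < d → ∃[ c ] c < d × (m + c) % d ≡ r
  %-complement m r r<d = c , m%n<n _ d , (begin
    (m + c) % d                    ≡⟨ [m+n%d]%d≡[m+n]%d m (r + d ∸ m % d) ⟩
    (m + (r + d ∸ m % d)) % d      ≡⟨ [m%d+n]%d≡[m+n]%d m (r + d ∸ m % d) ⟨
    (m % d + (r + d ∸ m % d)) % d  ≡⟨ cong (_% d) (m+[n∸m]≡n (≤-trans (m%n≤n m d) (m≤n+m d r))) ⟩
    (r + d) % d                    ≡⟨ [m+n]%n≡m%n r d ⟩
    r % d                          ≡⟨ m<n⇒m%n≡m r<d ⟩
    r                              ∎)
    where
    c : ℕ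
    c = (r + d ∸ m % d) % d

  +-cancelˡ-% : ∀ m {x y} → x < d → y < d → (m + x) % d ≡ (m + y) % d → x ≡ y
  +-cancelˡ-% m {x} {y} x<d y<d eq = begin
    x                      ≡⟨ recover x<d ⟩
    (c + (m + x) % d) % d  ≡⟨ cong (λ z → (c + z) % d) eq ⟩
    (c + (m + y) % d) % d  ≡⟨ recover y<d ⟨
    y                      ∎
    where
    complement : ∃[ c ] c < d × (m + c) % d ≡ 0
    complement = %-complement m 0 (>-nonZero⁻¹ d)
    c : ℕ
    c = proj₁ complement
    recover : ∀ {z} → z < d → z ≡ (c + (m + z) % d) % d
    recover {z} z<d = begin
      z                      ≡⟨ m<n⇒m%n≡m z<d ⟨
      z % d                  ≡⟨ cong (λ u → (u + z) % d) (proj₂ (proj₂ complement)) ⟨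
      ((m + c) % d + z) % d  ≡⟨ [m%d+n]%d≡[m+n]%d (m + c) z ⟩
      (m + c + z) % d        ≡⟨ cong (λ u → (u + z) % d) (+-comm m c) ⟩
      (c + m + z) % d        ≡⟨ cong (_% d) (+-assoc c m z) ⟩
      (c + (m + z)) % d      ≡⟨ [m+n%d]%d≡[m+n]%d c (m + z) ⟨
      (c + (m + z) % d) % d  ∎

countBelow : (ℕ → Bool) → ℕ → ℕ
countBelow P n = ∣ tabulate {n = n} (P ∘ toℕ) ∣

countBelow-+ : ∀ P m n → countBelow P (m + n) ≡ countBelow P m + countBelow (λ i → P (m + i)) n
countBelow-+ P zero    n = refl
countBelow-+ P (suc m) n with P 0
... | true  = cong suc (countBelow-+ (P ∘ suc) m n)
... | false = countBelow-+ (P ∘ suc) m n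

countBelow-hit : ∀ P {n j} → j < n → T (P j) → 1 ≤ countBelow P n
countBelow-hit P {suc n} {zero}  _         Pj with P 0
... | true = s≤s z≤n
countBelow-hit P {suc n} {suc j} (s≤s j<n) Pj with P 0
... | true  = s≤s z≤n
... | false = countBelow-hit (P ∘ suc) j<n Pj

Syndetic : ℕ → (ℕ → Bool) → Set
Syndetic d P = ∀ o → ∃[ j ] j < d × T (P (o + j))

syndetic-shift : ∀ {d} P m → Syndetic d P → Syndetic d (λ i → P (m + i))
syndetic-shift P m syn o with syn (m + o)
... | j , j<d , hit = j , j<d , subst (T ∘ P) (+-assoc m o j) hit

syndetic-blocks : ∀ {d} P q → Syndetic d P → q ≤ countBelow P (q * d)
syndetic-blocks P zero    syn = z≤n
syndetic-blocks {d} P (suc q) syn with syn 0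
... | j , j<d , hit = begin
  1 + q                                                  ≤⟨ +-mono-≤ (countBelow-hit P j<d hit)
                                                              (syndetic-blocks (λ i → P (d + i)) q (syndetic-shift P d syn)) ⟩
  countBelow P d + countBelow (λ i → P (d + i)) (q * d)  ≡⟨ countBelow-+ P d (q * d) ⟨
  countBelow P (d + q * d)                               ∎
  where open ≤-Reasoning

syndetic-density : ∀ {d} .{{_ : NonZero d}} P n → Syndetic d P → n / d ≤ countBelow P n
syndetic-density {d} P n syn = begin
  n / d                             ≤⟨ syndetic-blocks P (n / d) syn ⟩
  countBelow P (n / d * d)          ≤⟨ m≤m+n _ _ ⟩
  countBelow P (n / d * d) + _      ≡⟨ countBelow-+ P (n / d * d) (n % d) ⟨
  countBelow P (n / d * d + n % d)  ≡⟨ cong (countBelow P) n≡ ⟩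
  countBelow P n                    ∎
  where
  open ≤-Reasoning
  n≡ : n / d * d + n % d ≡ n
  n≡ = trans (+-comm (n / d * d) (n % d)) (sym (m≡m%n+[m/n]*n n d))

residue-syndetic : ∀ {d} .{{_ : NonZero d}} r → r < d → Syndetic d (λ i → i % d ≡ᵇ r)
residue-syndetic r r<d o with %-complement o r r<d
... | j , j<d , eq = j , j<d , ≡⇒≡ᵇ _ _ eq

-- Sums over subsets

subsetSum : ∀ {n} → (Fin n → ℕ) → Subset n → ℕ
subsetSum w []            = 0
subsetSum w (inside  ∷ p) = w zero + subsetSum (w ∘ suc) p
subsetSum w (outside ∷ p) = subsetSum (w ∘ suc) p

subsetSum-cong : ∀ {n} {w w′ : Fin n → ℕ} p → (∀ v → w v ≡ w′ v) → subsetSum w p ≡ subsetSum w′ p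
subsetSum-cong []            eq = refl
subsetSum-cong (inside  ∷ p) eq = cong₂ _+_ (eq zero) (subsetSum-cong p (eq ∘ suc))
subsetSum-cong (outside ∷ p) eq = subsetSum-cong p (eq ∘ suc)

subsetSum-const-⊤ : ∀ n c → subsetSum (const c) (⊤ {n}) ≡ n * c
subsetSum-const-⊤ zero    c = refl
subsetSum-const-⊤ (suc n) c = cong (c +_) (subsetSum-const-⊤ n c)

subsetSum-tabulate-false : ∀ {n} (w : Fin n → ℕ) → subsetSum w (tabulate (const false)) ≡ 0
subsetSum-tabulate-false {zero}  w = refl
subsetSum-tabulate-false {suc n} w = subsetSum-tabulate-false (w ∘ suc)

∣p∣≡subsetSum-1 : ∀ {n} (p : Subset n) → ∣ p ∣ ≡ subsetSum (const 1) p
∣p∣≡subsetSum-1 []            = refl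
∣p∣≡subsetSum-1 (inside  ∷ p) = cong suc (∣p∣≡subsetSum-1 p)
∣p∣≡subsetSum-1 (outside ∷ p) = ∣p∣≡subsetSum-1 p

subsetSum-∪⁅⁆ : ∀ {n} (w : Fin n → ℕ) p x → lookup p x ≡ outside →
  subsetSum w (p ∪ ⁅ x ⁆) ≡ subsetSum w p + w x
subsetSum-∪⁅⁆ w (outside ∷ p) zero    _   =
  trans (cong (w zero +_) (cong (subsetSum (w ∘ suc)) (∪-identityʳ p))) (+-comm (w zero) (subsetSum (w ∘ suc) p))
subsetSum-∪⁅⁆ w (inside  ∷ p) (suc x) x∉p =
  trans (cong (w zero +_) (subsetSum-∪⁅⁆ (w ∘ suc) p x x∉p))
    (sym (+-assoc (w zero) (subsetSum (w ∘ suc) p) (w (suc x))))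
subsetSum-∪⁅⁆ w (outside ∷ p) (suc x) x∉p = subsetSum-∪⁅⁆ (w ∘ suc) p x x∉p

∣p∪⁅x⁆∣≡1+∣p∣ : ∀ {n} (p : Subset n) x → lookup p x ≡ outside → ∣ p ∪ ⁅ x ⁆ ∣ ≡ suc ∣ p ∣
∣p∪⁅x⁆∣≡1+∣p∣ p x x∉p = begin
  ∣ p ∪ ⁅ x ⁆ ∣                     ≡⟨ ∣p∣≡subsetSum-1 (p ∪ ⁅ x ⁆) ⟩
  subsetSum (const 1) (p ∪ ⁅ x ⁆)  ≡⟨ subsetSum-∪⁅⁆ (const 1) p x x∉p ⟩
  subsetSum (const 1) p + 1        ≡⟨ cong (_+ 1) (∣p∣≡subsetSum-1 p) ⟨
  ∣ p ∣ + 1                         ≡⟨ +-comm ∣ p ∣ 1 ⟩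
  suc ∣ p ∣                         ∎
  where open ≡-Reasoning

∈-tabulate⁻ : ∀ {n} {f : Fin n → Bool} {x} → x ∈ tabulate f → f x ≡ true
∈-tabulate⁻ {f = f} {x} x∈ = trans (sym (lookup∘tabulate f x)) ([]=⇒lookup x∈)

∈-tabulate⁺ : ∀ {n} {f : Fin n → Bool} {x} → f x ≡ true → x ∈ tabulate f
∈-tabulate⁺ {f = f} {x} fx = lookup⇒[]= x (tabulate f) (trans (lookup∘tabulate f x) fx)

∣p∪q∣≤∣p∣+∣q∣ : ∀ {n} (p q : Subset n) → ∣ p ∪ q ∣ ≤ ∣ p ∣ + ∣ q ∣
∣p∪q∣≤∣p∣+∣q∣ []            []            = z≤n
∣p∪q∣≤∣p∣+∣q∣ (inside  ∷ p) (inside  ∷ q) =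
  s≤s (≤-trans (∣p∪q∣≤∣p∣+∣q∣ p q) (≤-trans (n≤1+n _) (≤-reflexive (sym (+-suc ∣ p ∣ ∣ q ∣)))))
∣p∪q∣≤∣p∣+∣q∣ (inside  ∷ p) (outside ∷ q) = s≤s (∣p∪q∣≤∣p∣+∣q∣ p q)
∣p∪q∣≤∣p∣+∣q∣ (outside ∷ p) (inside  ∷ q) =
  ≤-trans (s≤s (∣p∪q∣≤∣p∣+∣q∣ p q)) (≤-reflexive (sym (+-suc ∣ p ∣ ∣ q ∣)))
∣p∪q∣≤∣p∣+∣q∣ (outside ∷ p) (outside ∷ q) = ∣p∪q∣≤∣p∣+∣q∣ p q

lookup-⁅⁆ : ∀ {n} (x y : Fin n) → lookup ⁅ x ⁆ y ≡ (x == y)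
lookup-⁅⁆ zero    zero    = refl
lookup-⁅⁆ zero    (suc y) = lookup-replicate y outside
lookup-⁅⁆ (suc x) zero    = refl
lookup-⁅⁆ (suc x) (suc y) = lookup-⁅⁆ x y

lookup-∪⁅⁆ : ∀ {n} (p : Subset n) x y → lookup (p ∪ ⁅ x ⁆) y ≡ (lookup p y ∨ (x == y))
lookup-∪⁅⁆ p x y = trans (lookup-zipWith _∨_ y p ⁅ x ⁆) (cong (lookup p y ∨_) (lookup-⁅⁆ x y))

lookup-ext : ∀ {A : Set} {n} {xs ys : Vec A n} → (∀ i → lookup xs i ≡ lookup ys i) → xs ≡ ys
lookup-ext {xs = xs} {ys} eq = trans (sym (tabulate∘lookup xs)) (trans (tabulate-cong eq) (tabulate∘lookup ys))

anyᵇ-cong : ∀ {m} {f g : Fin m → Bool} → (∀ v → f v ≡ g v) → anyᵇ f ≡ anyᵇ g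
anyᵇ-cong {zero}  eq = refl
anyᵇ-cong {suc m} eq = cong₂ _∨_ (eq zero) (anyᵇ-cong (eq ∘ suc))

anyᵇ-false : ∀ {m} (f : Fin m → Bool) → (∀ v → f v ≡ false) → anyᵇ f ≡ false
anyᵇ-false {zero}  f none = refl
anyᵇ-false {suc m} f none rewrite none zero = anyᵇ-false (f ∘ suc) (none ∘ suc)

lookup-image-⊤ : ∀ {m n} (φ : Fin m → Fin n) y → lookup (image φ ⊤) y ≡ anyᵇ (λ v → φ v == y)
lookup-image-⊤ φ y = trans (lookup∘tabulate _ y) (anyᵇ-cong (λ v → cong (_∧ (φ v == y)) (lookup-replicate v inside)))

image-∌ : ∀ {m n} (φ : Fin m → Fin n) e y → (∀ v → φ v ≢ y) → lookup (image φ e) y ≡ outside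
image-∌ φ e y miss = trans (lookup∘tabulate _ y)
  (anyᵇ-false _ (λ v → trans (cong (lookup e v ∧_) (dec-false (φ v Fin.≟ y) (miss v))) (∧-zeroʳ _)))

image-inside : ∀ {m n} (φ : Fin (suc m) → Fin n) e → image φ (inside ∷ e) ≡ image (φ ∘ suc) e ∪ ⁅ φ zero ⁆
image-inside φ e = lookup-ext λ y → begin
  lookup (image φ (inside ∷ e)) y               ≡⟨ lookup∘tabulate _ y ⟩
  (φ zero == y) ∨ _                             ≡⟨ ∨-comm (φ zero == y) _ ⟩
  _ ∨ (φ zero == y)                             ≡⟨ cong (_∨ (φ zero == y)) (lookup∘tabulate _ y) ⟨
  lookup (image (φ ∘ suc) e) y ∨ (φ zero == y)  ≡⟨ lookup-∪⁅⁆ (image (φ ∘ suc) e) (φ zero) y ⟨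
  lookup (image (φ ∘ suc) e ∪ ⁅ φ zero ⁆) y     ∎
  where open ≡-Reasoning

subsetSum-image : ∀ {m n} (w : Fin n → ℕ) {φ : Fin m → Fin n} → Injective _≡_ _≡_ φ → ∀ e →
  subsetSum w (image φ e) ≡ subsetSum (w ∘ φ) e
subsetSum-image w         inj []            = subsetSum-tabulate-false w
subsetSum-image w         inj (outside ∷ e) = subsetSum-image w (Fin-suc-injective ∘ inj) e
subsetSum-image w {φ} inj (inside  ∷ e) = begin
  subsetSum w (image φ (inside ∷ e))            ≡⟨ cong (subsetSum w) (image-inside φ e) ⟩
  subsetSum w (image (φ ∘ suc) e ∪ ⁅ φ zero ⁆)  ≡⟨ subsetSum-∪⁅⁆ w (image (φ ∘ suc) e) (φ zero) φ0∉ ⟩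
  subsetSum w (image (φ ∘ suc) e) + w (φ zero)  ≡⟨ cong (_+ w (φ zero)) (subsetSum-image w (Fin-suc-injective ∘ inj) e) ⟩
  subsetSum (w ∘ φ ∘ suc) e + w (φ zero)        ≡⟨ +-comm (subsetSum (w ∘ φ ∘ suc) e) (w (φ zero)) ⟩
  subsetSum (w ∘ φ) (inside ∷ e)                ∎
  where
  open ≡-Reasoning
  φ0∉ : lookup (image (φ ∘ suc) e) (φ zero) ≡ outside
  φ0∉ = image-∌ (φ ∘ suc) e (φ zero) (λ v eq → 0≢1+n (sym (inj eq)))

-- The edges of the zycle

toℕ-sucMod : ∀ {ℓ} (i : Fin (suc ℓ)) → toℕ (sucMod i) ≡ suc (toℕ i) % suc ℓ
toℕ-sucMod i = toℕ-fromℕ< _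

sucMod-mod : ∀ ℓ j → sucMod (j mod suc ℓ) ≡ suc j mod suc ℓ
sucMod-mod ℓ j = toℕ-injective (begin
  toℕ (sucMod (j mod suc ℓ))       ≡⟨ toℕ-sucMod (j mod suc ℓ) ⟩
  suc (toℕ (j mod suc ℓ)) % suc ℓ  ≡⟨ cong (λ x → suc x % suc ℓ) (toℕ-fromℕ< _) ⟩
  (1 + j % suc ℓ) % suc ℓ          ≡⟨ [m+n%d]%d≡[m+n]%d {suc ℓ} 1 j ⟩
  suc j % suc ℓ                    ≡⟨ toℕ-fromℕ< _ ⟨
  toℕ (suc j mod suc ℓ)            ∎)
  where open ≡-Reasoning

n-mod-n≡zero : ∀ ℓ → suc ℓ mod suc ℓ ≡ zero
n-mod-n≡zero ℓ = toℕ-injective (trans (toℕ-fromℕ< _) (n%n≡0 (suc ℓ)))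

sucMod-fixedPointFree : ∀ {ℓ} (i : Fin (2 + ℓ)) → sucMod i ≢ i
sucMod-fixedPointFree {ℓ} i fixed = 1+n≢0 (+-cancelˡ-% (toℕ i) (s≤s (s≤s z≤n)) (s≤s z≤n) i+1≡i+0)
  where
  open ≡-Reasoning
  i+1≡i+0 : (toℕ i + 1) % (2 + ℓ) ≡ (toℕ i + 0) % (2 + ℓ)
  i+1≡i+0 = begin
    (toℕ i + 1) % (2 + ℓ)  ≡⟨ cong (_% (2 + ℓ)) (+-comm (toℕ i) 1) ⟩
    suc (toℕ i) % (2 + ℓ)  ≡⟨ toℕ-sucMod i ⟨
    toℕ (sucMod i)         ≡⟨ cong toℕ fixed ⟩
    toℕ i                  ≡⟨ m<n⇒m%n≡m (toℕ<n i) ⟨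
    toℕ i % (2 + ℓ)        ≡⟨ cong (_% (2 + ℓ)) (+-identityʳ (toℕ i)) ⟨
    (toℕ i + 0) % (2 + ℓ)  ∎

zblock : ∀ k {ℓ} → Fin ℓ → Subset (ℓ * (k ∸ 1))
zblock k i = image (combine i) (⊤ {k ∸ 1})

zedge≡zblock∪⁅next⁆ : ∀ k {ℓ} (i : Fin ℓ) j → zedge k i j ≡ zblock k i ∪ ⁅ combine (sucMod i) j ⁆
zedge≡zblock∪⁅next⁆ k i j = lookup-ext λ w → begin
  lookup (zedge k i j) w
    ≡⟨ lookup∘tabulate _ w ⟩
  anyᵇ (λ j′ → combine i j′ == w) ∨ (combine (sucMod i) j == w)
    ≡⟨ cong₂ _∨_ (lookup-image-⊤ (combine i) w) (lookup-⁅⁆ (combine (sucMod i) j) w) ⟨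
  lookup (zblock k i) w ∨ lookup ⁅ combine (sucMod i) j ⁆ w
    ≡⟨ lookup-zipWith _∨_ w (zblock k i) ⁅ combine (sucMod i) j ⁆ ⟨
  lookup (zblock k i ∪ ⁅ combine (sucMod i) j ⁆) w
    ∎
  where open ≡-Reasoning

subsetSum-zedge : ∀ k {ℓ} (w : Fin ((2 + ℓ) * (k ∸ 1)) → ℕ) (i : Fin (2 + ℓ)) j →
  subsetSum w (zedge k i j) ≡ subsetSum (w ∘ combine i) (⊤ {k ∸ 1}) + w (combine (sucMod i) j)
subsetSum-zedge k w i j = begin
  subsetSum w (zedge k i j)
    ≡⟨ cong (subsetSum w) (zedge≡zblock∪⁅next⁆ k i j) ⟩
  subsetSum w (zblock k i ∪ ⁅ combine (sucMod i) j ⁆)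
    ≡⟨ subsetSum-∪⁅⁆ w (zblock k i) _ next∉block ⟩
  subsetSum w (zblock k i) + w (combine (sucMod i) j)
    ≡⟨ cong (_+ w (combine (sucMod i) j)) (subsetSum-image w combine-i-inj (⊤ {k ∸ 1})) ⟩
  subsetSum (w ∘ combine i) (⊤ {k ∸ 1}) + w (combine (sucMod i) j)
    ∎
  where
  open ≡-Reasoning
  combine-i-inj : Injective _≡_ _≡_ (combine {n = k ∸ 1} i)
  combine-i-inj {x} {y} = combine-injectiveʳ i x i y
  next∉block : lookup (zblock k i) (combine (sucMod i) j) ≡ outside
  next∉block = image-∌ (combine i) ⊤ _
    (λ v eq → sucMod-fixedPointFree i (sym (combine-injectiveˡ i v (sucMod i) j eq)))

-- The residue k-graph

does≡true⇒ : ∀ {A : Set} (a? : Dec A) → does a? ≡ true → A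
does≡true⇒ (yes a) _  = a
does≡true⇒ (no _)  ()

colour : ∀ M .{{_ : NonZero M}} {n} → Fin n → ℕ
colour M v = toℕ v % M

residueEdge? : ∀ k M .{{_ : NonZero M}} {n} (e : Subset n) → Dec (∣ e ∣ ≡ k × subsetSum (colour M) e % M ≡ 1)
residueEdge? k M e = ∣ e ∣ ℕ.≟ k ×-dec subsetSum (colour M) e % M ℕ.≟ 1

residueGraph : ∀ k M .{{_ : NonZero M}} n → HostGraph n
residueGraph k M n e = does (residueEdge? k M e)

module _ (k M : ℕ) .{{_ : NonZero M}} {n : ℕ} (e : Subset n) where

  residueGraph-edge⁻ : residueGraph k M n e ≡ true → ∣ e ∣ ≡ k × subsetSum (colour M) e % M ≡ 1
  residueGraph-edge⁻ = does≡true⇒ (residueEdge? k M e)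

  residueGraph-edge⁺ : ∣ e ∣ ≡ k → subsetSum (colour M) e % M ≡ 1 → residueGraph k M n e ≡ true
  residueGraph-edge⁺ card sum = dec-true (residueEdge? k M e) (card , sum)

residueGraph-isKGraph : ∀ k M .{{_ : NonZero M}} n → IsKGraph k (residueGraph k M n)
residueGraph-isKGraph k M n e = proj₁ ∘ residueGraph-edge⁻ k M e

residueGraph-minCodeg : ∀ a M .{{_ : NonZero M}} n → 1 < M →
  MinCodegAtLeast (suc a) (residueGraph (suc a) M n) (n / M ∸ a)
residueGraph-minCodeg a M n 1<M S ∣S∣≡a = m≤n+o⇒m∸n≤o (n / M) a (begin
  n / M                       ≤⟨ syndetic-density (λ i → i % M ≡ᵇ r) n (residue-syndetic r r<M) ⟩
  ∣ completers ∣              ≤⟨ p⊆q⇒∣p∣≤∣q∣ completers⊆ ⟩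
  ∣ neighbours ∪ S ∣          ≤⟨ ∣p∪q∣≤∣p∣+∣q∣ neighbours S ⟩
  ∣ neighbours ∣ + ∣ S ∣      ≡⟨ +-comm ∣ neighbours ∣ ∣ S ∣ ⟩
  ∣ S ∣ + ∣ neighbours ∣      ≡⟨ cong (_+ ∣ neighbours ∣) ∣S∣≡a ⟩
  a + codeg H S               ∎)
  where
  open ≤-Reasoning
  H : HostGraph n
  H = residueGraph (suc a) M n
  complement : ∃[ r ] r < M × (subsetSum (colour M) S + r) % M ≡ 1
  complement = %-complement (subsetSum (colour M) S) 1 1<M
  r : ℕ
  r = proj₁ complement
  r<M : r < M
  r<M = proj₁ (proj₂ complement)
  completers neighbours : Subset n
  completers = tabulate (λ v → toℕ v % M ≡ᵇ r)
  neighbours = tabulate (λ v → not (lookup S v) ∧ H (S ∪ ⁅ v ⁆))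

  completes : ∀ v → lookup S v ≡ outside → colour M v ≡ r → H (S ∪ ⁅ v ⁆) ≡ true
  completes v v∉S colour≡r = residueGraph-edge⁺ (suc a) M (S ∪ ⁅ v ⁆)
    (trans (∣p∪⁅x⁆∣≡1+∣p∣ S v v∉S) (cong suc ∣S∣≡a))
    (trans (cong (_% M) (subsetSum-∪⁅⁆ (colour M) S v v∉S))
      (trans (cong (λ c → (subsetSum (colour M) S + c) % M) colour≡r) (proj₂ (proj₂ complement))))

  completers⊆ : completers ⊆ neighbours ∪ S
  completers⊆ {v} v∈ with lookup S v in Sv
  ... | inside  = x∈p∪q⁺ (inj₂ (lookup⇒[]= v S Sv))
  ... | outside = x∈p∪q⁺ (inj₁ (∈-tabulate⁺
    (trans (cong (λ b → not b ∧ H (S ∪ ⁅ v ⁆)) Sv) (completes v Sv colour≡r))))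
    where
    colour≡r : colour M v ≡ r
    colour≡r = ≡ᵇ⇒≡ _ _ (Equivalence.from T-≡ (∈-tabulate⁻ v∈))

module ZycleCopy {b m n M : ℕ} .{{_ : NonZero M}}
  (φ : Fin ((2 + m) * suc b) → Fin n) (φ-inj : Injective _≡_ _≡_ φ)
  (edges : ∀ e → Zycle (2 + b) (2 + m) e → residueGraph (2 + b) M n (image φ e) ≡ true) where

  W : Fin ((2 + m) * suc b) → ℕ
  W = colour M ∘ φ

  blockSum : Fin (2 + m) → ℕ
  blockSum i = subsetSum (W ∘ combine i) (⊤ {suc b})

  edge-colourSum : ∀ i j → (blockSum i + W (combine (sucMod i) j)) % M ≡ 1
  edge-colourSum i j = begin
    (blockSum i + W (combine (sucMod i) j)) % M  ≡⟨ cong (_% M) (subsetSum-zedge (2 + b) W i j) ⟨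
    subsetSum W e % M                            ≡⟨ cong (_% M) (subsetSum-image (colour M) φ-inj e) ⟨
    subsetSum (colour M) (image φ e) % M         ≡⟨ proj₂ (residueGraph-edge⁻ (2 + b) M (image φ e) (edges e (i , j , refl))) ⟩
    1                                            ∎
    where
    open ≡-Reasoning
    e : Subset ((2 + m) * suc b)
    e = zedge (2 + b) i j

  nextColour : Fin (2 + m) → ℕ
  nextColour i = W (combine (sucMod i) zero)

  -- Every vertex of block i+1 completes block i to an edge, and colours are residues modulo M.
  next-block-monochromatic : ∀ i j → W (combine (sucMod i) j) ≡ nextColour i
  next-block-monochromatic i j = +-cancelˡ-% (blockSum i) (m%n<n _ M) (m%n<n _ M)
    (trans (edge-colourSum i j) (sym (edge-colourSum i zero)))

  nextColour-recurrence : ∀ i → (suc b * nextColour i + nextColour (sucMod i)) % M ≡ 1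
  nextColour-recurrence i =
    trans (cong (λ s → (s + nextColour (sucMod i)) % M) (sym blockSum≡)) (edge-colourSum (sucMod i) zero)
    where
    blockSum≡ : blockSum (sucMod i) ≡ suc b * nextColour i
    blockSum≡ = trans (subsetSum-cong ⊤ (next-block-monochromatic i)) (subsetSum-const-⊤ (suc b) (nextColour i))

residueGraph-zycleFree : ∀ b m n .{{_ : NonZero (zycleModulus (suc b) (2 + m))}} →
  ¬ ContainsCopy (Zycle (2 + b) (2 + m)) (residueGraph (2 + b) (zycleModulus (suc b) (2 + m)) n)
residueGraph-zycleFree b m n (φ , φ-inj , edges) =
  no-periodic-orbit (suc b) (2 + m) u u-recurrence (cong nextColour (n-mod-n≡zero (suc m)))
  where
  open ZycleCopy φ φ-inj edges
  u : ℕ → ℕ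
  u j = nextColour (j mod (2 + m))
  u-recurrence : ∀ j → (suc b * u j + u (suc j)) % zycleModulus (suc b) (2 + m) ≡ 1
  u-recurrence j = subst (λ i → (suc b * u j + nextColour i) % _ ≡ 1) (sucMod-mod (suc m) j)
    (nextColour-recurrence (j mod (2 + m)))

-- Density

zycleModulus-bounds : ∀ a ℓ → 2 ≤ a → 2 ≤ ℓ → 1 < zycleModulus a ℓ × zycleModulus a ℓ ≤ 2 * a ^ ℓ
zycleModulus-bounds a ℓ 2≤a 2≤ℓ =
  +-cancelˡ-≤ 1 2 (zycleModulus a ℓ) (≤-trans (n≤1+n 3) (≤-trans 4≤a^ℓ (a^ℓ≤1+zycleModulus a ℓ))) ,
  ≤-trans (zycleModulus≤1+a^ℓ a ℓ) (begin
    1 + a ^ ℓ          ≤⟨ +-monoˡ-≤ (a ^ ℓ) (≤-trans (s≤s z≤n) 4≤a^ℓ) ⟩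
    a ^ ℓ + a ^ ℓ      ≡⟨ cong (a ^ ℓ +_) (+-identityʳ (a ^ ℓ)) ⟨
    2 * a ^ ℓ          ∎)
  where
  open ≤-Reasoning
  4≤a^ℓ : 4 ≤ a ^ ℓ
  4≤a^ℓ = ≤-trans (^-monoˡ-≤ 2 2≤a) (^-monoʳ-≤ a {{>-nonZero (≤-trans (s≤s z≤n) 2≤a)}} 2≤ℓ)

m≤m∸n+n : ∀ m n → m ≤ m ∸ n + n
m≤m∸n+n m n with ≤-total n m
... | inj₁ n≤m = ≤-reflexive (sym (m∸n+n≡m n≤m))
... | inj₂ m≤n = ≤-trans m≤n (m≤n+m n (m ∸ n))

n≤[n/M∸c]*M+[1+c]*M : ∀ n M c .{{_ : NonZero M}} → n ≤ (n / M ∸ c) * M + suc c * M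
n≤[n/M∸c]*M+[1+c]*M n M c = begin
  n                              ≡⟨ m≡m%n+[m/n]*n n M ⟩
  n % M + n / M * M              ≤⟨ +-monoˡ-≤ (n / M * M) (m%n≤n n M) ⟩
  suc (n / M) * M                ≤⟨ *-monoˡ-≤ M (s≤s (m≤m∸n+n (n / M) c)) ⟩
  suc (n / M ∸ c + c) * M        ≡⟨ cong (_* M) (+-suc (n / M ∸ c) c) ⟨
  (n / M ∸ c + suc c) * M        ≡⟨ *-distribʳ-+ M (n / M ∸ c) (suc c) ⟩
  (n / M ∸ c) * M + suc c * M    ∎
  where open ≤-Reasoning

density-bound : ∀ n M c t T .{{_ : NonZero M}} → M ≤ T → suc c * M * suc t ≤ n →
  n * suc t ≤ (n / M ∸ c) * T * suc t + n * T
density-bound n M c t T M≤T large = begin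
  n * suc t                                ≤⟨ *-monoˡ-≤ (suc t) (n≤[n/M∸c]*M+[1+c]*M n M c) ⟩
  (d * M + suc c * M) * suc t              ≡⟨ *-distribʳ-+ (suc t) (d * M) (suc c * M) ⟩
  d * M * suc t + suc c * M * suc t        ≤⟨ +-mono-≤ (*-monoˡ-≤ (suc t) (*-monoʳ-≤ d M≤T)) large ⟩
  d * T * suc t + n                        ≤⟨ +-monoʳ-≤ (d * T * suc t) (m≤m*n n T {{T-nonZero}}) ⟩
  d * T * suc t + n * T                    ∎
  where
  open ≤-Reasoning
  d : ℕ
  d = n / M ∸ c
  T-nonZero : NonZero T
  T-nonZero = >-nonZero (≤-trans (>-nonZero⁻¹ M) M≤T)

lemma2p6 : (k : ℕ) → k ≥ 3 → (ℓ : ℕ) → ℓ ≥ 2 →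
    (t : ℕ) → ∃[ N ] ((n : ℕ) → n ≥ N →
      ∃[ d ] (ExCoAtLeast k (Zycle k ℓ) n d ×
        n * suc t ≤ d * (2 * (k ∸ 1) ^ ℓ) * suc t + n * (2 * (k ∸ 1) ^ ℓ)))
lemma2p6 (suc (suc (suc b))) _ (suc (suc m)) _ t =
  suc a * M * suc t , λ n n≥N → n / M ∸ a ,
    (residueGraph k M n , residueGraph-isKGraph k M n , residueGraph-zycleFree (suc b) m n ,
       residueGraph-minCodeg a M n (proj₁ bounds)) ,
    density-bound n M a t (2 * a ^ ℓ) (proj₂ bounds) n≥N
  where
  a k ℓ M : ℕ
  a = suc (suc b)
  k = suc a
  ℓ = suc (suc m)
  M = zycleModulus a ℓ
  bounds : 1 < M × M ≤ 2 * a ^ ℓ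
  bounds = zycleModulus-bounds a ℓ (s≤s (s≤s z≤n)) (s≤s (s≤s z≤n))
  instance
    M-nonZero : NonZero M
    M-nonZero = >-nonZero (<-trans (s≤s z≤n) (proj₁ bounds))
lemma2p6 0                   ()
lemma2p6 1                   (s≤s ())
lemma2p6 2                   (s≤s (s≤s ()))
lemma2p6 (suc (suc (suc _))) _ 0 ()
lemma2p6 (suc (suc (suc _))) _ 1 (s≤s ())
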